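{- For every $\varepsilon>0$ there exist a graph $G$ and a partition $\Gamma$ of its edge set into nonempty groups such that, with edge utilities, $\mathrm{DF\text{ - }MP}(G,\Gamma)-\mathrm{SF\text{ - }MP}(G,\Gamma)>1-\varepsilon$.
   Context: Max-Cut with edge utilities: $G=(V,E)$ is a finite simple graph and $\Gamma=\{E_1,\ldots,E_\gamma\}$ is a partition of $E$ into nonempty groups. A cut is a subset $S\subseteq V$; for an edge $e$, $X_e(S)=1$ if $e$ has exactly one endpoint in $S$ and $0$ otherwise. For $F\subseteq E$, $f_S(F)=\sum_{e\in F}X_e(S)$. Define $\mathrm{SF\text{ - }MP}(G,\Gamma)=\max_{S\subseteq V}\min_{i\in[\gamma]}f_S(E_i)/|E_i|$ and $\mathrm{DF\text{ - }MP}(G,\Gamma)=\max_{D}\min_{i\in[\gamma]}\mathbb{E}_{S\sim D}f_S(E_i)/|E_i|$, where the outer maximum is over all probability distributions $D$ on the subsets of $V$.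
   Formalization: The parameter ε ranges over the positive rationals, and the distribution D bounding DF-MP from below is taken among finitely supported distributions with rational probabilities. -}

module Defs where

open import Data.Bool using (Bool; true; false; if_then_else_; _xor_)
open import Data.Nat as ℕ using (ℕ; zero; suc)
open import Data.Integer using (+_)
open import Data.Fin using (Fin; toℕ; _≟_)
open import Data.Fin as Fin using ()
open import Data.Fin.Subset using (Subset)
open import Data.Vec using (Vec; []; _∷_; lookup)
open import Data.List using (List; []; _∷_; map; length; filter; foldr; _++_)
open import Data.List.Relation.Unary.All using (All)
open import Data.List.Relation.Unary.Unique.Propositional using (Unique)
open import Data.Product using (_×_; _,_; Σ; proj₁; proj₂)
open import Data.Rational using (ℚ; 0ℚ; 1ℚ; _/_; _+_; _*_; _⊔_; _⊓_; _≤_)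
open import Relation.Nullary.Decidable using (does)
open import Relation.Binary.PropositionalEquality using (_≡_)
open import Data.List.Membership.Propositional using (_∈_)

Edge : ℕ → Set
Edge n = Fin n × Fin n

-- A finite simple graph on vertex set Fin n: a duplicate-free list of edges,
-- each stored with its smaller endpoint first (so no loops and no parallel edges).
record Graph : Set where
  field
    n      : ℕ
    edges  : List (Edge n)
    normal : All (λ e → toℕ (proj₁ e) ℕ.< toℕ (proj₂ e)) edges
    unique : Unique edges
open Graph public

-- A partition Γ = {E_0,…,E_g} of the edge set into γ = suc g nonempty groups:
-- every edge receives a group label and every group label is used.
record EdgePartition (G : Graph) : Set where
  field
    g        : ℕ
    label    : Edge (n G) → Fin (suc g)
    nonempty : (i : Fin (suc g)) → Σ (Edge (n G)) λ e →
                 e ∈ edges G × label e ≡ i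
open EdgePartition public


X : {n : ℕ} → Edge n → Subset n → ℕ
X (u , v) S = if lookup S u xor lookup S v then 1 else 0

group : (G : Graph) (Γ : EdgePartition G) → Fin (suc (g Γ)) → List (Edge (n G))
group G Γ i = filter (λ e → label Γ e ≟ i) (edges G)

f : {n : ℕ} → Subset n → List (Edge n) → ℕ
f S F = foldr (λ e acc → X e S ℕ.+ acc) 0 F

-- a / k as a rational (k = 0 never occurs for nonempty groups).
ratio : ℕ → ℕ → ℚ
ratio a zero    = 0ℚ
ratio a (suc k) = (+ a) / suc k

groupRatio : (G : Graph) (Γ : EdgePartition G) → Subset (n G) → Fin (suc (g Γ)) → ℚ
groupRatio G Γ S i = ratio (f S (group G Γ i)) (length (group G Γ i))

minFin : (k : ℕ) → (Fin (suc k) → ℚ) → ℚ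
minFin zero    h = h Fin.zero
minFin (suc k) h = h Fin.zero ⊓ minFin k (λ i → h (Fin.suc i))

allSubsets : (n : ℕ) → List (Subset n)
allSubsets zero    = [] ∷ []
allSubsets (suc n) = map (true ∷_) (allSubsets n) ++ map (false ∷_) (allSubsets n)

-- SF-MP(G,Γ) = max_S min_i f_S(E_i)/|E_i|  (all values are ≥ 0, list nonempty)
SF-MP : (G : Graph) → EdgePartition G → ℚ
SF-MP G Γ = foldr (λ S acc → minFin (g Γ) (groupRatio G Γ S) ⊔ acc) 0ℚ (allSubsets (n G))

-- A (finitely supported, rational) probability distribution on subsets of Fin n:
-- a list of (weight, subset) pairs with nonnegative weights summing to 1.
record Distribution (n : ℕ) : Set where
  field
    support  : List (ℚ × Subset n)
    nonneg   : All (λ p → 0ℚ ≤ proj₁ p) support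
    sumToOne : foldr (λ p acc → proj₁ p + acc) 0ℚ support ≡ 1ℚ
open Distribution public

expectedRatio : (G : Graph) (Γ : EdgePartition G) → Distribution (n G) → Fin (suc (g Γ)) → ℚ
expectedRatio G Γ D i =
  foldr (λ p acc → proj₁ p * groupRatio G Γ (proj₂ p) i + acc) 0ℚ (support D)

-- The objective value min_i E_{S∼D} f_S(E_i)/|E_i| of a distribution D;
-- DF-MP(G,Γ) is the maximum of this over all D.
DF-value : (G : Graph) (Γ : EdgePartition G) → Distribution (n G) → ℚ
DF-value G Γ D = minFin (g Γ) (expectedRatio G Γ D)

-- An odd cycle with every edge in its own group separates the two objectives.
-- No single cut of an odd cycle cuts every edge, so some group has ratio 0 and SF-MP = 0.
-- On the other hand, for each edge there is a cut missing exactly that edge, and the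
-- uniform distribution over these N cuts gives every group expected ratio 1 − 1/N.
-- Taking N odd and larger than 1/ε gives a gap above 1 − ε.
module Submission where

open import Defs
open import Data.Rational using (ℚ; 0ℚ; 1ℚ; _<_; _-_)
open import Data.Product using (Σ)

open import Data.Bool using (Bool; true; false; not; _xor_; if_then_else_; _∧_)
import Data.Bool as Bool
open import Data.Bool.Properties
  using (not-involutive; T-≡; xor-same; xor-identityʳ; not-distribˡ-xor; not-distribʳ-xor; ¬-not)
open import Data.Fin as Fin using (Fin; zero; suc; toℕ; inject₁)
import Data.Fin.Properties as FinP
open import Data.Fin.Subset using (Subset)
open import Data.Integer as ℤ using (+[1+_]; -[1+_])
open import Data.Integer.Tactic.RingSolver using (solve-∀)
open import Data.List using (List; []; _∷_; filter; foldr; length; tabulate)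
open import Data.List.Membership.Propositional.Properties using (∈-tabulate⁺)
open import Data.List.Properties using (filter-accept; filter-reject; filter-none)
open import Data.List.Relation.Unary.All using (All; []; _∷_)
open import Data.List.Relation.Unary.All.Properties using () renaming (tabulate⁺ to All-tabulate⁺)
open import Data.List.Relation.Unary.Unique.Propositional.Properties
  using () renaming (tabulate⁺ to Unique-tabulate⁺)
open import Data.Nat as ℕ using (ℕ; _≡ᵇ_; _<ᵇ_; _≤ᵇ_)
import Data.Nat.Properties as ℕP
open import Data.Nat.Coprimality using (Coprime; 1-coprimeTo) renaming (sym to coprime-sym)
open import Data.Product using (_×_; _,_; proj₁; proj₂)
open import Data.Rational using (mkℚ; _+_; _*_; _≤_; _⊔_; 1/_; *<*; *≤*)
import Data.Rational.Properties as ℚP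
import Data.Rational.Unnormalised as ℚᵘ
import Data.Rational.Unnormalised.Properties as ℚᵘP
open import Data.Sum using (_⊎_; inj₁; inj₂)
open import Data.Vec using (lookup)
open import Data.Vec.Properties using (lookup∘tabulate)
import Data.Vec as Vec
open import Function using (_∘_; Equivalence)
import Algebra.Properties.Group as GroupProperties
open import Relation.Nullary using (yes; no; does)
open import Relation.Nullary.Decidable using (dec-true)
open import Relation.Unary using (Pred; Decidable)
open import Relation.Binary.PropositionalEquality

module ℚ+ = GroupProperties ℚP.+-0-group

fromℕ : ℕ → ℚ
fromℕ k = mkℚ (ℤ.+ k) 0 (coprime-sym (1-coprimeTo k))

fromℕ-suc : ∀ k → fromℕ (ℕ.suc k) ≡ 1ℚ + fromℕ k
fromℕ-suc k = ℚP.toℚᵘ-injective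
  (ℚᵘP.≃-trans (ℚᵘ.*≡* (identity (ℤ.+ k))) (ℚᵘP.≃-sym (ℚP.toℚᵘ-homo-+ 1ℚ (fromℕ k))))
  where
  -- the cross-multiplied form of (1 + k)/1 ≃ 1/1 + k/1 in ℚᵘ
  identity : ∀ x → (ℤ.+ 1 ℤ.+ x) ℤ.* (ℤ.+ 1 ℤ.* ℤ.+ 1)
                  ≡ (ℤ.+ 1 ℤ.* ℤ.+ 1 ℤ.+ x ℤ.* ℤ.+ 1) ℤ.* ℤ.+ 1
  identity = solve-∀

minFin-lowerBound : ∀ k (h : Fin (ℕ.suc k) → ℚ) i → minFin k h ≤ h i
minFin-lowerBound ℕ.zero    h zero    = ℚP.≤-refl
minFin-lowerBound (ℕ.suc k) h zero    = ℚP.p⊓q≤p (h zero) _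
minFin-lowerBound (ℕ.suc k) h (suc i) =
  ℚP.≤-trans (ℚP.p⊓q≤q (h zero) _) (minFin-lowerBound k (h ∘ suc) i)

minFin-glb : ∀ k (h : Fin (ℕ.suc k) → ℚ) {c} → (∀ i → c ≤ h i) → c ≤ minFin k h
minFin-glb ℕ.zero    h c≤h = c≤h zero
minFin-glb (ℕ.suc k) h c≤h = ℚP.⊓-glb (c≤h zero) (minFin-glb k (h ∘ suc) (c≤h ∘ suc))

filter-tabulate-unique : ∀ {a p} {A : Set a} {P : Pred A p} (P? : Decidable P) {k}
  (h : Fin k → A) (i : Fin k) → P (h i) → (∀ j → P (h j) → j ≡ i) →
  filter P? (tabulate h) ≡ h i ∷ []
filter-tabulate-unique P? h zero Phi unique = begin
  filter P? (tabulate h)          ≡⟨ filter-accept P? Phi ⟩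
  h zero ∷ filter P? (tabulate (h ∘ suc))
    ≡⟨ cong (h zero ∷_) (filter-none P? (All-tabulate⁺ λ j Phj →
                                             FinP.0≢1+n (sym (unique (suc j) Phj)))) ⟩
  h zero ∷ []                     ∎
  where open ≡-Reasoning
filter-tabulate-unique P? h (suc i) Phi unique = trans
  (filter-reject P? λ Ph0 → FinP.0≢1+n (unique zero Ph0))
  (filter-tabulate-unique P? (h ∘ suc) i Phi (λ j Phj → FinP.suc-injective (unique (suc j) Phj)))

module _ {a} {A : Set a} where

  totalWeight : List (ℚ × A) → ℚ
  totalWeight = foldr (λ p acc → proj₁ p + acc) 0ℚ

  weightedSum : (A → ℚ) → List (ℚ × A) → ℚ
  weightedSum φ = foldr (λ p acc → proj₁ p * φ (proj₂ p) + acc) 0ℚ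

  weightedSum-one : ∀ (φ : A → ℚ) {L} → All (λ p → φ (proj₂ p) ≡ 1ℚ) L →
                    weightedSum φ L ≡ totalWeight L
  weightedSum-one φ []                      = refl
  weightedSum-one φ {(w , _) ∷ _} (φx≡1 ∷ rest) =
    cong₂ _+_ (trans (cong (w *_) φx≡1) (ℚP.*-identityʳ w)) (weightedSum-one φ rest)

  weightedSum-allButOne : ∀ (φ : A → ℚ) {k} (h : Fin k → ℚ × A) (i : Fin k) →
    φ (proj₂ (h i)) ≡ 0ℚ → (∀ j → j ≢ i → φ (proj₂ (h j)) ≡ 1ℚ) →
    weightedSum φ (tabulate h) + proj₁ (h i) ≡ totalWeight (tabulate h)
  weightedSum-allButOne φ h zero φhi≡0 φh≡1 = begin
    (w * φ S + weightedSum φ (tabulate (h ∘ suc))) + w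
      ≡⟨ cong (λ x → (x + weightedSum φ (tabulate (h ∘ suc))) + w)
              (trans (cong (w *_) φhi≡0) (ℚP.*-zeroʳ w)) ⟩
    (0ℚ + weightedSum φ (tabulate (h ∘ suc))) + w
      ≡⟨ cong (_+ w) (ℚP.+-identityˡ (weightedSum φ (tabulate (h ∘ suc)))) ⟩
    weightedSum φ (tabulate (h ∘ suc)) + w
      ≡⟨ ℚP.+-comm (weightedSum φ (tabulate (h ∘ suc))) w ⟩
    w + weightedSum φ (tabulate (h ∘ suc))
      ≡⟨ cong (w +_) (weightedSum-one φ (All-tabulate⁺ λ j → φh≡1 (suc j) λ ())) ⟩
    w + totalWeight (tabulate (h ∘ suc)) ∎
    where
    open ≡-Reasoning
    w = proj₁ (h zero)
    S = proj₂ (h zero)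
  weightedSum-allButOne φ h (suc i) φhi≡0 φh≡1 = begin
    (w * φ S + weightedSum φ (tabulate (h ∘ suc))) + proj₁ (h (suc i))
      ≡⟨ ℚP.+-assoc (w * φ S) _ _ ⟩
    w * φ S + (weightedSum φ (tabulate (h ∘ suc)) + proj₁ (h (suc i)))
      ≡⟨ cong₂ _+_ (trans (cong (w *_) (φh≡1 zero λ ())) (ℚP.*-identityʳ w))
                   (weightedSum-allButOne φ (h ∘ suc) i φhi≡0
                     (λ j j≢i → φh≡1 (suc j) (j≢i ∘ FinP.suc-injective))) ⟩
    w + totalWeight (tabulate (h ∘ suc)) ∎
    where
    open ≡-Reasoning
    w = proj₁ (h zero)
    S = proj₂ (h zero)

  totalWeight-constant : ∀ w {k} (h : Fin k → A) →
                         totalWeight (tabulate (λ j → w , h j)) ≡ fromℕ k * w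
  totalWeight-constant w {ℕ.zero}  h = sym (ℚP.*-zeroˡ w)
  totalWeight-constant w {ℕ.suc k} h = begin
    w + totalWeight (tabulate (λ j → w , h (suc j))) ≡⟨ cong (w +_) (totalWeight-constant w (h ∘ suc)) ⟩
    w + fromℕ k * w                                   ≡⟨ cong (_+ fromℕ k * w) (ℚP.*-identityˡ w) ⟨
    1ℚ * w + fromℕ k * w                              ≡⟨ ℚP.*-distribʳ-+ w 1ℚ (fromℕ k) ⟨
    (1ℚ + fromℕ k) * w                                ≡⟨ cong (_* w) (fromℕ-suc k) ⟨
    fromℕ (ℕ.suc k) * w                               ∎
    where open ≡-Reasoning

SF-MP-≤ : ∀ G Γ {c} → 0ℚ ≤ c → (∀ S → minFin (g Γ) (groupRatio G Γ S) ≤ c) → SF-MP G Γ ≤ c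
SF-MP-≤ G Γ 0≤c min≤c = go (allSubsets (n G))
  where
  go : ∀ L → foldr (λ S acc → minFin (g Γ) (groupRatio G Γ S) ⊔ acc) 0ℚ L ≤ _
  go []      = 0≤c
  go (S ∷ L) = ℚP.⊔-lub (min≤c S) (go L)

odd : ℕ → Bool
odd ℕ.zero    = false
odd (ℕ.suc k) = not (odd k)

double : ℕ → ℕ
double ℕ.zero    = ℕ.zero
double (ℕ.suc k) = ℕ.suc (ℕ.suc (double k))

odd-double : ∀ k → odd (double k) ≡ false
odd-double ℕ.zero    = refl
odd-double (ℕ.suc k) = trans (not-involutive (odd (double k))) (odd-double k)

<-double-suc : ∀ k → k ℕ.< double (ℕ.suc k)
<-double-suc ℕ.zero    = ℕ.z<s
<-double-suc (ℕ.suc k) = ℕ.s<s (ℕP.m<n⇒m<1+n (<-double-suc k))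

xor-not-xor : ∀ p q r → (p xor q) xor (not p xor r) ≡ not (q xor r)
xor-not-xor false q r = sym (not-distribʳ-xor q r)
xor-not-xor true  q r = sym (not-distribˡ-xor q r)

<ᵇ-xor-<ᵇ-suc : ∀ j i → (j <ᵇ i) xor (j <ᵇ ℕ.suc i) ≡ (j ≡ᵇ i)
<ᵇ-xor-<ᵇ-suc ℕ.zero    ℕ.zero    = refl
<ᵇ-xor-<ᵇ-suc ℕ.zero    (ℕ.suc i) = refl
<ᵇ-xor-<ᵇ-suc (ℕ.suc j) ℕ.zero    = refl
<ᵇ-xor-<ᵇ-suc (ℕ.suc j) (ℕ.suc i) = <ᵇ-xor-<ᵇ-suc j i

≤ᵇ-xor-≤ᵇ-suc : ∀ j i → (j ≤ᵇ i) xor (j ≤ᵇ ℕ.suc i) ≡ (j ≡ᵇ ℕ.suc i)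
≤ᵇ-xor-≤ᵇ-suc ℕ.zero    i = refl
≤ᵇ-xor-≤ᵇ-suc (ℕ.suc j) i = <ᵇ-xor-<ᵇ-suc j i

≡ᵇ-refl : ∀ k → (k ≡ᵇ k) ≡ true
≡ᵇ-refl ℕ.zero    = refl
≡ᵇ-refl (ℕ.suc k) = ≡ᵇ-refl k

≢⇒≡ᵇ-false : ∀ {j i} → j ≢ i → (j ≡ᵇ i) ≡ false
≢⇒≡ᵇ-false {j} {i} j≢i = ¬-not (j≢i ∘ ℕP.≡ᵇ⇒≡ j i ∘ Equivalence.from T-≡)

monochromatic⊎alternating : ∀ k (s : Fin (ℕ.suc k) → Bool) →
  (Σ (Fin k) λ i → s (inject₁ i) ≡ s (suc i)) ⊎ (s (Fin.fromℕ k) ≡ s zero xor odd k)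
monochromatic⊎alternating ℕ.zero s = inj₂ (sym (xor-identityʳ (s zero)))
monochromatic⊎alternating (ℕ.suc k) s with monochromatic⊎alternating k (s ∘ inject₁)
... | inj₁ (i , same) = inj₁ (inject₁ i , same)
... | inj₂ alt with s (inject₁ (Fin.fromℕ k)) Bool.≟ s (suc (Fin.fromℕ k))
...   | yes same = inj₁ (Fin.fromℕ k , same)
...   | no  diff = inj₂ (trans (¬-not (diff ∘ sym))
                          (trans (cong not alt) (not-distribʳ-xor (s zero) (odd k))))

X-monochromatic : ∀ {n} (e : Edge n) S → lookup S (proj₁ e) ≡ lookup S (proj₂ e) → X e S ≡ 0
X-monochromatic (u , v) S same rewrite same | xor-same (lookup S v) = refl

1-w≤x⇒1-ε<x-y : ∀ {x y w ε} → 1ℚ - w ≤ x → y ≤ 0ℚ → w < ε → 1ℚ - ε < x - y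
1-w≤x⇒1-ε<x-y {x} {y} {w} {ε} 1-w≤x y≤0 w<ε = begin-strict
  1ℚ - ε  <⟨ ℚP.+-monoʳ-< 1ℚ (ℚP.neg-antimono-< w<ε) ⟩
  1ℚ - w  ≤⟨ 1-w≤x ⟩
  x       ≡⟨ ℚP.+-identityʳ x ⟨
  x + 0ℚ  ≤⟨ ℚP.+-monoʳ-≤ x (ℚP.neg-antimono-≤ y≤0) ⟩
  x - y   ∎
  where open ℚP.≤-Reasoning

module OddCycle (m : ℕ) where

  K : ℕ
  K = double (ℕ.suc m)

  N : ℕ
  N = ℕ.suc K

  last : Fin N
  last = Fin.fromℕ K

  edge : Fin N → Edge N
  edge zero    = zero , last
  edge (suc i) = inject₁ i , suc i

  edgeIndex : Edge N → Fin N
  edgeIndex (u , v) = if does (u Fin.≟ zero) ∧ does (v Fin.≟ last) then zero else v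

  edgeIndex-edge : ∀ i → edgeIndex (edge i) ≡ i
  edgeIndex-edge zero rewrite dec-true (last Fin.≟ last) refl = refl
  edgeIndex-edge (suc zero)    = refl
  edgeIndex-edge (suc (suc i)) = refl

  edge-injective : ∀ {i j} → edge i ≡ edge j → i ≡ j
  edge-injective {i} {j} eq =
    trans (sym (edgeIndex-edge i)) (trans (cong edgeIndex eq) (edgeIndex-edge j))

  edge-ordered : ∀ i → toℕ (proj₁ (edge i)) ℕ.< toℕ (proj₂ (edge i))
  edge-ordered zero    rewrite FinP.toℕ-fromℕ K = ℕ.z<s
  edge-ordered (suc i) rewrite FinP.toℕ-inject₁ i = ℕP.n<1+n (toℕ i)

  graph : Graph
  graph = record
    { n      = N
    ; edges  = tabulate edge
    ; normal = All-tabulate⁺ edge-ordered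
    ; unique = Unique-tabulate⁺ edge-injective
    }

  singletons : EdgePartition graph
  singletons = record
    { g        = K
    ; label    = edgeIndex
    ; nonempty = λ i → edge i , ∈-tabulate⁺ {f = edge} i , edgeIndex-edge i
    }

  group-singleton : ∀ i → group graph singletons i ≡ edge i ∷ []
  group-singleton i = filter-tabulate-unique (λ e → edgeIndex e Fin.≟ i) edge i
    (edgeIndex-edge i) (λ j eq → trans (sym (edgeIndex-edge j)) eq)

  groupRatio-singleton : ∀ S i → groupRatio graph singletons S i ≡ ratio (X (edge i) S) 1
  groupRatio-singleton S i = trans
    (cong (λ L → ratio (f S L) (length L)) (group-singleton i))
    (cong (λ x → ratio x 1) (ℕP.+-identityʳ (X (edge i) S)))

  everyCut-missesEdge : ∀ S → Σ (Fin N) λ i → X (edge i) S ≡ 0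
  everyCut-missesEdge S with monochromatic⊎alternating K (lookup S)
  ... | inj₁ (i , same) = suc i , X-monochromatic (edge (suc i)) S same
  ... | inj₂ alt        = zero , X-monochromatic (edge zero) S (sym (begin
    lookup S last                ≡⟨ alt ⟩
    lookup S zero xor odd K      ≡⟨ cong (lookup S zero xor_) (odd-double (ℕ.suc m)) ⟩
    lookup S zero xor false      ≡⟨ xor-identityʳ (lookup S zero) ⟩
    lookup S zero                ∎))
    where open ≡-Reasoning

  SF-MP-nonpositive : SF-MP graph singletons ≤ 0ℚ
  SF-MP-nonpositive = SF-MP-≤ graph singletons ℚP.≤-refl λ S →
    let (i , missed) = everyCut-missesEdge S in
    ℚP.≤-trans (minFin-lowerBound K (groupRatio graph singletons S) i)
      (ℚP.≤-reflexive (trans (groupRatio-singleton S i) (cong (λ x → ratio x 1) missed)))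

  -- The proper 2-colouring of the path 0 … K with the colours of all vertices ≥ j swapped:
  -- only edge j is monochromatic (for j = 0 that is the closing edge, as K is even).
  colour : Fin N → Fin N → Bool
  colour j v = odd (toℕ v) xor (toℕ j ≤ᵇ toℕ v)

  cut : Fin N → Subset N
  cut j = Vec.tabulate (colour j)

  colour-last : ∀ j → colour j last ≡ true
  colour-last j = cong₂ _xor_ (trans (cong odd (FinP.toℕ-fromℕ K)) (odd-double (ℕ.suc m)))
                              (Equivalence.to T-≡ (ℕP.≤⇒≤ᵇ (FinP.≤fromℕ j)))

  cut-separates : ∀ j i →
    lookup (cut j) (proj₁ (edge i)) xor lookup (cut j) (proj₂ (edge i)) ≡ not (toℕ j ≡ᵇ toℕ i)
  cut-separates j zero
    rewrite lookup∘tabulate (colour j) zero | lookup∘tabulate (colour j) last | colour-last j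
    with j
  ... | zero   = refl
  ... | suc _  = refl
  cut-separates j (suc i)
    rewrite lookup∘tabulate (colour j) (inject₁ i) | lookup∘tabulate (colour j) (suc i)
          | FinP.toℕ-inject₁ i = begin
    (odd (toℕ i) xor (toℕ j ≤ᵇ toℕ i)) xor (not (odd (toℕ i)) xor (toℕ j ≤ᵇ ℕ.suc (toℕ i)))
      ≡⟨ xor-not-xor (odd (toℕ i)) _ _ ⟩
    not ((toℕ j ≤ᵇ toℕ i) xor (toℕ j ≤ᵇ ℕ.suc (toℕ i)))
      ≡⟨ cong not (≤ᵇ-xor-≤ᵇ-suc (toℕ j) (toℕ i)) ⟩
    not (toℕ j ≡ᵇ ℕ.suc (toℕ i)) ∎
    where open ≡-Reasoning

  groupRatio-cut : ∀ j i →
    groupRatio graph singletons (cut j) i ≡ ratio (if not (toℕ j ≡ᵇ toℕ i) then 1 else 0) 1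
  groupRatio-cut j i = trans (groupRatio-singleton (cut j) i)
    (cong (λ b → ratio (if b then 1 else 0) 1) (cut-separates j i))

  cut-misses : ∀ i → groupRatio graph singletons (cut i) i ≡ 0ℚ
  cut-misses i rewrite groupRatio-cut i i | ≡ᵇ-refl (toℕ i) = refl

  cut-crosses : ∀ i j → j ≢ i → groupRatio graph singletons (cut j) i ≡ 1ℚ
  cut-crosses i j j≢i rewrite groupRatio-cut j i | ≢⇒≡ᵇ-false (j≢i ∘ FinP.toℕ-injective) = refl

  weight : ℚ
  weight = 1/ fromℕ N

  weightedCut : Fin N → ℚ × Subset N
  weightedCut j = weight , cut j

  uniformCuts : Distribution N
  uniformCuts = record
    { support  = tabulate weightedCut
    ; nonneg   = All-tabulate⁺ {f = weightedCut} (λ _ → *≤* (ℤ.+≤+ ℕ.z≤n))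
    ; sumToOne = trans (totalWeight-constant weight cut) (ℚP.*-inverseʳ (fromℕ N))
    }

  expectedRatio-uniformCuts : ∀ i → expectedRatio graph singletons uniformCuts i + weight ≡ 1ℚ
  expectedRatio-uniformCuts i = trans
    (weightedSum-allButOne (λ S → groupRatio graph singletons S i) weightedCut i
      (cut-misses i) (cut-crosses i))
    (sumToOne uniformCuts)

  DF-value-uniformCuts : 1ℚ - weight ≤ DF-value graph singletons uniformCuts
  DF-value-uniformCuts = minFin-glb K (expectedRatio graph singletons uniformCuts) λ i →
    ℚP.≤-reflexive (trans (cong (_- weight) (sym (expectedRatio-uniformCuts i)))
                          (ℚ+.//-rightDividesʳ weight _))

  weight<ε : ∀ p .{c : Coprime (ℕ.suc p) (ℕ.suc m)} → weight < mkℚ +[1+ p ] m c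
  weight<ε p = *<* (ℤ.+<+ (begin-strict
    1 ℕ.* ℕ.suc m      ≡⟨ ℕP.*-identityˡ (ℕ.suc m) ⟩
    ℕ.suc m            <⟨ ℕ.s<s (<-double-suc m) ⟩
    N                  ≤⟨ ℕP.m≤n*m N (ℕ.suc p) ⟩
    ℕ.suc p ℕ.* N      ∎))
    where open ℕP.≤-Reasoning

proposition4p6 : (ε : ℚ) → 0ℚ < ε →
    Σ Graph λ G → Σ (EdgePartition G) λ Γ → Σ (Distribution (n G)) λ D →
      1ℚ - ε < DF-value G Γ D - SF-MP G Γ
proposition4p6 (mkℚ +[1+ p ] d c) _ =
  graph , singletons , uniformCuts ,
  1-w≤x⇒1-ε<x-y DF-value-uniformCuts SF-MP-nonpositive (weight<ε p {c})
  where open OddCycle d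
proposition4p6 (mkℚ (ℤ.+ 0) _ _) (*<* (ℤ.+<+ ()))
proposition4p6 (mkℚ -[1+ _ ] _ _) (*<* ())
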